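{- Let $m\ge 1$ and let $\Gamma$ be a family of 1-regular digraphs, all having the same vertex set $V$, with $n=|V|$. Let $C_m^+$ be the directed cycle with vertex set $\{a_1,\dots,a_m\}$ and arcs $(a_i,a_{i+1})$, $1\le i\le m-1$, and $(a_m,a_1)$, and let $h:E(C_m^+)\to\Gamma$ be any function. Color $C_m^+$ with color sequence $(s_1,\dots,s_m)$ (arc $(a_i,a_{i+1})$ gets $s_i$, arc $(a_m,a_1)$ gets $s_m$), and give $M_h$ the induced arc coloring. Then $C_m^+\otimes_h\Gamma$ is strongly connected, that is, it is a strongly oriented cycle of length $mn$, if and only if $M_h$ is rainbow eulerian with color sequence $(s_1,s_2,\dots,s_m)$.
   Context: Product: for a digraph $D$, a family $\Gamma$ of digraphs all with vertex set $V$, and a function $h:E(D)\to\Gamma$, the digraph $D\otimes_h\Gamma$ has vertex set $V(D)\times V$, and $((a,x),(b,y))$ is an arc iff $(a,b)\in E(D)$ and $(x,y)\in E(h(a,b))$. For $h:E(C_m^+)\to\Gamma$, $M_h$ is the multidigraph with vertex set $V$ whose arc multiset is the union, with repetitions, of $E(h(e))$ over all $e\in E(C_m^+)$ (an arc $(x,y)$ lying in $h(e)$ for $r$ different arcs $e$ appears $r$ times). Induced coloring: each copy of an arc of $M_h$ coming from $h(e)$ receives the color of $e$. A circuit is a closed directed trail (no arc of the multidigraph used twice). For an arc-colored multidigraph with $l$ colors, a rainbow circuit with color sequence $(s_1,\dots,s_l)$ is a circuit whose consecutive arcs are colored $s_1,s_2,\dots,s_l,s_1,s_2,\dots$ cyclically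 (the sequence of $l$ colors repeats); the multidigraph is rainbow eulerian (with that color sequence) if it has an eulerian circuit that is such a rainbow circuit. A 1-regular digraph is one in which every vertex has in-degree and out-degree $1$. -}

module Defs where

open import Data.Nat using (ℕ; suc; NonZero)
open import Data.Nat.DivMod using (_mod_)
open import Data.Fin using (Fin; toℕ)
open import Data.Bool using (Bool; T)
open import Data.Product using (Σ; ∃!; _×_; _,_; proj₁; proj₂)
open import Relation.Binary.PropositionalEquality using (_≡_)
open import Relation.Binary.Construct.Closure.ReflexiveTransitive using (Star)
open import Function.Bundles using (_⤖_; Bijection)

-- A digraph on the vertex set V = Fin n, given by its (decidable) arc relation.
-- Loops are allowed.
Digraph : ℕ → Set
Digraph n = Fin n → Fin n → Bool

Arc : ∀ {n} → Digraph n → Fin n → Fin n → Set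
Arc G x y = T (G x y)

OneRegular : ∀ {n} → Digraph n → Set
OneRegular {n} G =
  ((x : Fin n) → ∃! _≡_ (λ y → Arc G x y)) ×
  ((y : Fin n) → ∃! _≡_ (λ x → Arc G x y))

next : ∀ m .{{_ : NonZero m}} → Fin m → Fin m
next m i = suc (toℕ i) mod m

-- Vertices of C_m^+ are Fin m; the arcs of C_m^+ are indexed by their tail
-- i : Fin m, arc i being (a_i , a_{next i}).

ProdArc : ∀ m .{{_ : NonZero m}} {n} → (Fin m → Digraph n) →
          (Fin m × Fin n) → (Fin m × Fin n) → Set
ProdArc m g (a , x) (b , y) = (b ≡ next m a) × Arc (g a) x y

StronglyConnected : ∀ {V : Set} → (V → V → Set) → Set
StronglyConnected {V} R = (u v : V) → Star R u v

-- The multidigraph M_g: its arcs are the triples (i, x, y) with (x,y) an arc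
-- of g i (one copy per arc i of C_m^+); arc (i, x, y) goes x → y and has
-- colour s i (induced colouring).
MArc : ∀ {m n} → (Fin m → Digraph n) → Set
MArc {m} {n} g = Σ (Fin m) λ i → Σ (Fin n) λ x → Σ (Fin n) λ y → Arc (g i) x y

mtail : ∀ {m n} {g : Fin m → Digraph n} → MArc g → Fin n
mtail e = proj₁ (proj₂ e)

mhead : ∀ {m n} {g : Fin m → Digraph n} → MArc g → Fin n
mhead e = proj₁ (proj₂ (proj₂ e))

mindex : ∀ {m n} {g : Fin m → Digraph n} → MArc g → Fin m
mindex e = proj₁ e

-- An eulerian circuit of M_g which is rainbow with colour sequence
-- (s_1,…,s_m): an enumeration c_0,…,c_{L-1} of ALL arcs of M_g, each exactly
-- once (a bijection Fin L ⤖ arcs), with head c_k = tail c_{k+1 mod L}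
-- (closed trail), and colour of c_k equal to s_{(k mod m)+1}.
record RainbowEulerianCircuit {C : Set} (m : ℕ) .{{_ : NonZero m}} {n : ℕ}
       (g : Fin m → Digraph n) (s : Fin m → C) : Set where
  field
    L        : ℕ
    {{L≢0}}  : NonZero L
    circuit  : Fin L ⤖ MArc g
  c : Fin L → MArc g
  c = Bijection.to circuit
  field
    closed   : (k : Fin L) → mhead {g = g} (c k) ≡ mtail {g = g} (c (next L k))
    rainbow  : (k : Fin L) → s (mindex {g = g} (c k)) ≡ s (toℕ k mod m)

RainbowEulerian : {C : Set} (m : ℕ) .{{_ : NonZero m}} {n : ℕ}
                  (g : Fin m → Digraph n) (s : Fin m → C) → Set
RainbowEulerian m g s = RainbowEulerianCircuit m g s

-- Every vertex (a , x) of the product has exactly one out-neighbour (a + 1 , σₐ x), where σₐ is the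
-- permutation given by the 1-regular digraph h(a); so the product is strongly connected iff this map
-- `step` is cyclic, i.e. a single cycle through all m n vertices.  The arcs of M_h correspond
-- bijectively to the vertices (the arc of colour a leaving x ↔ (a , x)), and under this bijection
-- walking along the cycle of `step` from a vertex of colour class 0 lists every arc once, consecutive
-- arcs meet head to tail, and colours advance cyclically.  Conversely, a rainbow eulerian circuit read
-- as the sequence of (colour, tail) pairs is a path of `step` through every vertex exactly once, and
-- injectivity of `step` forces its last vertex to be followed by its first.
module Submission where

open import Defs
open import Data.Nat using (ℕ; NonZero; zero; suc; pred; _+_; _*_; _∸_; _<_; _%_; _/_; s<s⁻¹)
open import Data.Nat.Properties
open import Data.Nat.DivMod using (_mod_; m≡m%n+[m/n]*n; m%n%n≡m%n; [m+n]%n≡m%n; %-distribˡ-+; m<n⇒m%n≡m)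
open import Data.Fin using (Fin; toℕ) renaming (_≟_ to _≟ᶠ_)
open import Data.Fin.Properties using (toℕ-injective; toℕ-fromℕ<; toℕ<n)
open import Data.Bool.Properties using (T-irrelevant)
open import Data.Product using (_×_; _,_; proj₁; proj₂; ∃)
open import Data.Product.Properties using (≡-dec)
open import Data.Empty using (⊥-elim)
open import Relation.Nullary using (¬_; yes; no)
open import Relation.Unary using (Decidable)
open import Relation.Binary.Definitions using (DecidableEquality; tri<; tri≈; tri>)
open import Relation.Binary.PropositionalEquality
open import Relation.Binary.Construct.Closure.ReflexiveTransitive using (Star; ε; _◅_; _◅◅_)
open import Function.Base using (_∘_)
open import Function.Definitions using (Injective)
open import Function.Bundles using (_⇔_; _⤖_; mk⤖; mk⇔; mk↔ₛ′; Bijection; Equivalence)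
open import Function.Properties.Inverse using (↔⇒⤖)
open import Function.Construct.Composition using (_⤖-∘_)
open import Function.Consequences.Propositional using (strictlySurjective⇒surjective)

least-witness : {P : ℕ → Set} → Decidable P → ∀ {k} → P k →
                ∃ λ d → P d × (∀ j → j < d → ¬ P j)
least-witness P? {zero} p₀ = 0 , p₀ , λ _ ()
least-witness P? {suc k} pₖ with P? 0
... | yes p₀ = 0 , p₀ , λ _ ()
... | no ¬p₀ with least-witness (P? ∘ suc) pₖ
...   | d , p_d , below = suc d , p_d , λ { zero _ → ¬p₀ ; (suc j) j<d → below j (s<s⁻¹ j<d) }

toℕ-mod : ∀ j n .{{_ : NonZero n}} → toℕ (j mod n) ≡ j % n
toℕ-mod j n = toℕ-fromℕ< _

toℕ-mod-< : ∀ {j n} .{{_ : NonZero n}} → j < n → toℕ (j mod n) ≡ j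
toℕ-mod-< {j} {n} j<n = trans (toℕ-mod j n) (m<n⇒m%n≡m j<n)

next-mod : ∀ j n .{{_ : NonZero n}} → next n (j mod n) ≡ suc j mod n
next-mod j n = toℕ-injective (begin
  toℕ (next n (j mod n))        ≡⟨ toℕ-mod (suc (toℕ (j mod n))) n ⟩
  (1 + toℕ (j mod n)) % n       ≡⟨ cong (λ r → (1 + r) % n) (toℕ-mod j n) ⟩
  (1 + j % n) % n               ≡⟨ %-distribˡ-+ 1 (j % n) n ⟩
  (1 % n + j % n % n) % n       ≡⟨ cong (λ r → (1 % n + r) % n) (m%n%n≡m%n j n) ⟩
  (1 % n + j % n) % n           ≡⟨ %-distribˡ-+ 1 j n ⟨
  suc j % n                     ≡⟨ toℕ-mod (suc j) n ⟨
  toℕ (suc j mod n)             ∎)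
  where open ≡-Reasoning

next-injective : ∀ n .{{_ : NonZero n}} → Injective _≡_ _≡_ (next n)
next-injective n {a} {b} eq = toℕ-injective (trans (sym (undo-next a)) (trans (cong (λ k → (toℕ k + pred n) % n) eq) (undo-next b)))
  where
  open ≡-Reasoning
  undo-next : ∀ a → (toℕ (next n a) + pred n) % n ≡ toℕ a
  undo-next a = begin
    (toℕ (next n a) + pred n) % n        ≡⟨ cong (λ r → (r + pred n) % n) (toℕ-mod (suc (toℕ a)) n) ⟩
    (suc (toℕ a) % n + pred n) % n       ≡⟨ %-distribˡ-+ (suc (toℕ a) % n) (pred n) n ⟩
    (suc (toℕ a) % n % n + pred n % n) % n ≡⟨ cong (λ r → (r + pred n % n) % n) (m%n%n≡m%n (suc (toℕ a)) n) ⟩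
    (suc (toℕ a) % n + pred n % n) % n   ≡⟨ %-distribˡ-+ (suc (toℕ a)) (pred n) n ⟨
    (suc (toℕ a) + pred n) % n           ≡⟨ cong (_% n) (trans (sym (+-suc (toℕ a) (pred n))) (cong (toℕ a +_) (suc-pred n))) ⟩
    (toℕ a + n) % n                      ≡⟨ [m+n]%n≡m%n (toℕ a) n ⟩
    toℕ a % n                            ≡⟨ m<n⇒m%n≡m (toℕ<n a) ⟩
    toℕ a                                ∎

module Orbits {A : Set} (f : A → A) where

  open import Function.Endo.Propositional A public using (_^_)
  open import Function.Endo.Propositional A using (^-homo)

  ^-+ : ∀ i j x → (f ^ (i + j)) x ≡ (f ^ i) ((f ^ j) x)
  ^-+ i j = cong-app (^-homo f i j)

  ^-suc : ∀ k x → (f ^ suc k) x ≡ (f ^ k) (f x)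
  ^-suc k x = trans (cong (λ i → (f ^ i) x) (+-comm 1 k)) (^-+ k 1 x)

  Cyclic : Set
  Cyclic = ∀ x y → ∃ λ k → (f ^ k) x ≡ y

  module _ {_⟶_ : A → A → Set} (⟶-step : ∀ x → x ⟶ f x) (⟶⇒step : ∀ {x y} → x ⟶ y → y ≡ f x) where

    star-^ : ∀ k x → Star _⟶_ x ((f ^ k) x)
    star-^ zero    x = ε
    star-^ (suc k) x = star-^ k x ◅◅ (⟶-step _ ◅ ε)

    star⇒^ : ∀ {x y} → Star _⟶_ x y → ∃ λ k → (f ^ k) x ≡ y
    star⇒^ ε = 0 , refl
    star⇒^ {x} (x⟶z ◅ z⟶⋆y) with ⟶⇒step x⟶z | star⇒^ z⟶⋆y
    ... | refl | k , fᵏ[fx]≡y = suc k , trans (^-suc k x) fᵏ[fx]≡y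

    stronglyConnected⇔cyclic : StronglyConnected _⟶_ ⇔ Cyclic
    stronglyConnected⇔cyclic = mk⇔
      (λ sc x y → star⇒^ (sc x y))
      (λ cyc x y → let (k , fᵏx≡y) = cyc x y in subst (Star _⟶_ x) fᵏx≡y (star-^ k x))

  ^-periodic : ∀ D {x} .{{_ : NonZero D}} → (f ^ D) x ≡ x → ∀ k → (f ^ k) x ≡ (f ^ (k % D)) x
  ^-periodic D {x} fᴰx≡x k = begin
    (f ^ k) x                                 ≡⟨ cong (λ i → (f ^ i) x) (m≡m%n+[m/n]*n k D) ⟩
    (f ^ (k % D + (k / D) * D)) x             ≡⟨ ^-+ (k % D) ((k / D) * D) x ⟩
    (f ^ (k % D)) ((f ^ ((k / D) * D)) x)     ≡⟨ cong (f ^ (k % D)) (multiples (k / D)) ⟩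
    (f ^ (k % D)) x                           ∎
    where
    open ≡-Reasoning
    multiples : ∀ q → (f ^ (q * D)) x ≡ x
    multiples zero    = refl
    multiples (suc q) = trans (^-+ D (q * D) x) (trans (cong (f ^ D) (multiples q)) fᴰx≡x)

  record Cycle (x : A) : Set where
    field
      length         : ℕ
      {{length≢0}}   : NonZero length
      vertex         : Fin length ⤖ A
    at : Fin length → A
    at = Bijection.to vertex
    field
      at-^           : ∀ k → at k ≡ (f ^ toℕ k) x
      at-next        : ∀ k → at (next length k) ≡ f (at k)

  module _ (f-injective : Injective _≡_ _≡_ f) where

    ^-cancel : ∀ k {x y} → (f ^ k) x ≡ (f ^ k) y → x ≡ y
    ^-cancel zero    eq = eq
    ^-cancel (suc k) eq = ^-cancel k (f-injective eq)

    cyclic⇒cycle : DecidableEquality A → Cyclic → ∀ x → Cycle x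
    cyclic⇒cycle _≟_ cyclic x = record
      { length  = D
      ; vertex  = mk⤖ (orbit-injective , strictlySurjective⇒surjective orbit-onto)
      ; at-^    = λ _ → refl
      ; at-next = λ k → begin
          (f ^ toℕ (next D k)) x    ≡⟨ cong (λ i → (f ^ i) x) (toℕ-mod (suc (toℕ k)) D) ⟩
          (f ^ (suc (toℕ k) % D)) x ≡⟨ ^-periodic D period (suc (toℕ k)) ⟨
          f ((f ^ toℕ k) x)         ∎
      }
      where
      open ≡-Reasoning
      Returns : ℕ → Set
      Returns d = (f ^ suc d) x ≡ x

      first-return : ∃ λ d → Returns d × (∀ j → j < d → ¬ Returns j)
      first-return = let (t , fᵗ[fx]≡x) = cyclic (f x) x in
        least-witness (λ d → (f ^ suc d) x ≟ x) {t} (trans (^-suc t x) fᵗ[fx]≡x)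

      D : ℕ
      D = suc (proj₁ first-return)

      period : (f ^ D) x ≡ x
      period = proj₁ (proj₂ first-return)

      orbit-injective< : ∀ {i j} → i < j → j < D → (f ^ i) x ≢ (f ^ j) x
      orbit-injective< {i} {j} i<j j<D fⁱx≡fʲx =
        proj₂ (proj₂ first-return) r (s<s⁻¹ (≤-<-trans (m≤n+m (suc r) i) (subst (_< D) (sym i+1+r≡j) j<D)))
          (sym (^-cancel i (begin
            (f ^ i) x                 ≡⟨ fⁱx≡fʲx ⟩
            (f ^ j) x                 ≡⟨ cong (λ k → (f ^ k) x) (sym i+1+r≡j) ⟩
            (f ^ (i + suc r)) x       ≡⟨ ^-+ i (suc r) x ⟩
            (f ^ i) ((f ^ suc r) x)   ∎)))
        where
        r : ℕ
        r = j ∸ suc i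
        i+1+r≡j : i + suc r ≡ j
        i+1+r≡j = trans (+-suc i r) (m+[n∸m]≡n i<j)

      orbit-injective : Injective _≡_ _≡_ (λ (k : Fin D) → (f ^ toℕ k) x)
      orbit-injective {k} {l} eq with <-cmp (toℕ k) (toℕ l)
      ... | tri< k<l _ _ = ⊥-elim (orbit-injective< k<l (toℕ<n l) eq)
      ... | tri≈ _ k≡l _ = toℕ-injective k≡l
      ... | tri> _ _ l<k = ⊥-elim (orbit-injective< l<k (toℕ<n k) (sym eq))

      orbit-onto : ∀ y → ∃ λ (k : Fin D) → (f ^ toℕ k) x ≡ y
      orbit-onto y = let (t , fᵗx≡y) = cyclic x y in
        t mod D , trans (cong (λ i → (f ^ i) x) (toℕ-mod t D)) (trans (sym (^-periodic D period t)) fᵗx≡y)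

    module _ {L : ℕ} .{{_ : NonZero L}} (w : ℕ → A)
             (w-step : ∀ {j} → suc j < L → w (suc j) ≡ f (w j))
             (w-injective : ∀ {i j} → i < L → j < L → w i ≡ w j → i ≡ j)
             (w-onto : ∀ y → ∃ λ j → j < L × w j ≡ y) where

      ^-along : ∀ k {i} → k + i < L → (f ^ k) (w i) ≡ w (k + i)
      ^-along zero    _       = refl
      ^-along (suc k) 1+k+i<L = trans (cong f (^-along k (<-trans (n<1+n _) 1+k+i<L))) (sym (w-step 1+k+i<L))

      pred[L]<L : pred L < L
      pred[L]<L = m≤pred[n]⇒suc[m]≤n ≤-refl

      -- If f (w (pred L)) were w (suc j), injectivity of f would give w j ≡ w (pred L), so j ≡ pred L.
      path-closes : f (w (pred L)) ≡ w 0
      path-closes with w-onto (f (w (pred L)))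
      ... | zero  , _     , w₀≡ = sym w₀≡
      ... | suc j , 1+j<L , w[1+j]≡ = ⊥-elim (<-irrefl (suc-pred L) (subst (λ i → suc i < L) j≡pred[L] 1+j<L))
        where
        j≡pred[L] : j ≡ pred L
        j≡pred[L] = w-injective (<-trans (n<1+n j) 1+j<L) pred[L]<L
                                (f-injective (trans (sym (w-step 1+j<L)) w[1+j]≡))

      path⇒cyclic : Cyclic
      path⇒cyclic x y with w-onto x | w-onto y
      ... | a , a<L , refl | b , b<L , refl = b + suc r , (begin
        (f ^ (b + suc r)) (w a)      ≡⟨ ^-+ b (suc r) (w a) ⟩
        (f ^ b) (f ((f ^ r) (w a)))  ≡⟨ cong ((f ^ b) ∘ f) (^-along r (subst (_< L) (sym r+a≡pred[L]) pred[L]<L)) ⟩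
        (f ^ b) (f (w (r + a)))      ≡⟨ cong (λ i → (f ^ b) (f (w i))) r+a≡pred[L] ⟩
        (f ^ b) (f (w (pred L)))     ≡⟨ cong (f ^ b) path-closes ⟩
        (f ^ b) (w 0)                ≡⟨ ^-along b (subst (_< L) (sym (+-identityʳ b)) b<L) ⟩
        w (b + 0)                    ≡⟨ cong w (+-identityʳ b) ⟩
        w b                          ∎)
        where
        open ≡-Reasoning
        r : ℕ
        r = pred L ∸ a
        r+a≡pred[L] : r + a ≡ pred L
        r+a≡pred[L] = m∸n+n≡m (<⇒≤pred a<L)

module Product (m : ℕ) .{{_ : NonZero m}} {n : ℕ} (g : Fin m → Digraph n)
               (regular : ∀ i → OneRegular (g i)) where

  Vertex : Set
  Vertex = Fin m × Fin n

  σ : Fin m → Fin n → Fin n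
  σ i x = proj₁ (proj₁ (regular i) x)

  σ-arc : ∀ i x → Arc (g i) x (σ i x)
  σ-arc i x = proj₁ (proj₂ (proj₁ (regular i) x))

  σ-unique : ∀ {i x y} → Arc (g i) x y → σ i x ≡ y
  σ-unique {i} {x} = proj₂ (proj₂ (proj₁ (regular i) x))

  in-unique : ∀ {i x x′ y} → Arc (g i) x y → Arc (g i) x′ y → x ≡ x′
  in-unique {i} {y = y} x⟶y x′⟶y = trans (sym (unique x⟶y)) (unique x′⟶y)
    where
    unique : ∀ {x} → Arc (g i) x y → proj₁ (proj₂ (regular i) y) ≡ x
    unique = proj₂ (proj₂ (proj₂ (regular i) y))

  σ-injective : ∀ i → Injective _≡_ _≡_ (σ i)
  σ-injective i {x} {x′} σx≡σx′ = in-unique (σ-arc i x) (subst (Arc (g i) x′) (sym σx≡σx′) (σ-arc i x′))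

  step : Vertex → Vertex
  step (a , x) = next m a , σ a x

  step-injective : Injective _≡_ _≡_ step
  step-injective {a , x} {b , y} eq with next-injective m (cong proj₁ eq)
  ... | refl = cong (a ,_) (σ-injective a (cong proj₂ eq))

  ⟶-step : ∀ u → ProdArc m g u (step u)
  ⟶-step (a , x) = refl , σ-arc a x

  ⟶⇒step : ∀ {u v} → ProdArc m g u v → v ≡ step u
  ⟶⇒step {a , x} (refl , x⟶y) = cong (next m a ,_) (sym (σ-unique x⟶y))

  open Orbits step

  arc : Vertex → MArc g
  arc (a , x) = a , x , σ a x , σ-arc a x

  position : MArc g → Vertex
  position (i , x , _ , _) = i , x

  arc-position : ∀ e → arc (position e) ≡ e
  arc-position (i , x , y , x⟶y) with σ-unique x⟶y
  ... | refl = cong (λ p → i , x , σ i x , p) (T-irrelevant (σ-arc i x) x⟶y)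

  vertices⤖arcs : Vertex ⤖ MArc g
  vertices⤖arcs = ↔⇒⤖ (mk↔ₛ′ arc position arc-position (λ _ → refl))

  step-position : ∀ e → proj₂ (step (position e)) ≡ mhead {g = g} e
  step-position (_ , _ , _ , x⟶y) = σ-unique x⟶y

  index-^ : ∀ k x → proj₁ ((step ^ k) (0 mod m , x)) ≡ k mod m
  index-^ zero    x = refl
  index-^ (suc k) x = trans (cong (next m) (index-^ k x)) (next-mod k m)

  module _ {C : Set} (s : Fin m → C) where

    cyclic⇒rainbowEulerian : .{{_ : NonZero n}} → Cyclic → RainbowEulerian m g s
    cyclic⇒rainbowEulerian cyclic = record
      { L       = length
      ; circuit = vertices⤖arcs ⤖-∘ vertex
      ; closed  = λ k → cong proj₂ (sym (at-next k))
      ; rainbow = λ k → cong s (trans (cong proj₁ (at-^ k)) (index-^ (toℕ k) _))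
      }
      where open Cycle (cyclic⇒cycle step-injective (≡-dec _≟ᶠ_ _≟ᶠ_) cyclic (0 mod m , 0 mod n))

    rainbowEulerian⇒cyclic : Injective _≡_ _≡_ s → RainbowEulerian m g s → Cyclic
    rainbowEulerian⇒cyclic s-injective R = path⇒cyclic step-injective w w-step w-injective w-onto
      where
      open RainbowEulerianCircuit R

      w : ℕ → Vertex
      w j = position (c (j mod L))

      index-w : ∀ {j} → j < L → proj₁ (w j) ≡ j mod m
      index-w {j} j<L = trans (s-injective (rainbow (j mod L))) (cong (_mod m) (toℕ-mod-< j<L))

      w-step : ∀ {j} → suc j < L → w (suc j) ≡ step (w j)
      w-step {j} 1+j<L = cong₂ _,_
        (trans (index-w 1+j<L) (sym (trans (cong (next m) (index-w (<-trans (n<1+n j) 1+j<L))) (next-mod j m))))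
        (sym (trans (step-position (c (j mod L))) (trans (closed (j mod L)) (cong (mtail {g = g} ∘ c) (next-mod j L)))))

      w-injective : ∀ {i j} → i < L → j < L → w i ≡ w j → i ≡ j
      w-injective {i} {j} i<L j<L wᵢ≡wⱼ = trans (sym (toℕ-mod-< i<L)) (trans (cong toℕ (Bijection.injective circuit cᵢ≡cⱼ)) (toℕ-mod-< j<L))
        where
        cᵢ≡cⱼ : c (i mod L) ≡ c (j mod L)
        cᵢ≡cⱼ = trans (sym (arc-position _)) (trans (cong arc wᵢ≡wⱼ) (arc-position _))

      w-onto : ∀ y → ∃ λ j → j < L × w j ≡ y
      w-onto y = let (k , cₖ≡arc[y]) = Bijection.strictlySurjective circuit (arc y) in
        toℕ k , toℕ<n k , trans (cong (position ∘ c) (toℕ-injective (toℕ-mod-< (toℕ<n k)))) (cong position cₖ≡arc[y])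

    stronglyConnected⇔rainbowEulerian : .{{_ : NonZero n}} → Injective _≡_ _≡_ s →
                                        StronglyConnected (ProdArc m g) ⇔ RainbowEulerian m g s
    stronglyConnected⇔rainbowEulerian s-injective = mk⇔
      (cyclic⇒rainbowEulerian ∘ Equivalence.to connectivity)
      (Equivalence.from connectivity ∘ rainbowEulerian⇒cyclic s-injective)
      where
      connectivity : StronglyConnected (ProdArc m g) ⇔ Cyclic
      connectivity = stronglyConnected⇔cyclic ⟶-step ⟶⇒step

theorem2p1 : (m : ℕ) .{{_ : NonZero m}} (n : ℕ) .{{_ : NonZero n}}
    (I : Set) (Γ : I → Digraph n) → ((γ : I) → OneRegular (Γ γ)) →
    (h : Fin m → I) →
    (C : Set) (s : Fin m → C) → Injective _≡_ _≡_ s →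
    StronglyConnected (ProdArc m (λ i → Γ (h i))) ⇔ RainbowEulerian m (λ i → Γ (h i)) s
theorem2p1 m n I Γ regular h C s s-injective =
  Product.stronglyConnected⇔rainbowEulerian m (Γ ∘ h) (regular ∘ h) s s-injective
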